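{- Let $g(t)=\sum_k a_kt^k\in\mathbb{C}[t]$, let $n$ be a positive integer and $\ell\ge0$ an integer. Then $[n]_t^{\ell+1}$ divides $g(t)$ if and only if for every $r\in\{0,1,\dots,\ell\}$, \[ \sum_{k\equiv0\bmod n}a_kk^r=\sum_{k\equiv1\bmod n}a_kk^r=\cdots=\sum_{k\equiv n-1\bmod n}a_kk^r . \]
   Context: $[n]_t:=\frac{1-t^n}{1-t}=1+t+\dots+t^{n-1}$. The convention $0^0=1$ is used for $k=0,r=0$. -}

module Defs where

open import Level using (Level; _⊔_; suc)
open import Algebra.Bundles using (CommutativeRing)
open import Data.Nat as ℕ using (ℕ; zero; NonZero; _%_; _≤_)
import Data.Nat.Properties as ℕP
open import Data.Fin using (Fin; toℕ)
open import Data.List using (List; []; _∷_; replicate; map)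
open import Data.Product using (∃; Σ)
open import Relation.Nullary using (¬_; yes; no)
open import Relation.Binary.PropositionalEquality using (_≡_)

-- Polynomials over a commutative ring R, represented by coefficient lists
-- [a₀ , a₁ , … , a_d]  (so g(t) = Σ_k a_k t^k).  Two lists represent the
-- same polynomial iff all their coefficients agree (trailing zeros ignored).
module Poly {c ℓ : Level} (R : CommutativeRing c ℓ) where
  open CommutativeRing R

  Pol : Set c
  Pol = List Carrier

  fromℕ : ℕ → Carrier
  fromℕ zero = 0#
  fromℕ (ℕ.suc m) = 1# + fromℕ m

  coeff : Pol → ℕ → Carrier
  coeff [] k = 0#
  coeff (a ∷ p) zero = a
  coeff (a ∷ p) (ℕ.suc k) = coeff p k

  _≈ₚ_ : Pol → Pol → Set ℓ
  p ≈ₚ q = ∀ k → coeff p k ≈ coeff q k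

  _+ₚ_ : Pol → Pol → Pol
  [] +ₚ q = q
  (a ∷ p) +ₚ [] = a ∷ p
  (a ∷ p) +ₚ (b ∷ q) = (a + b) ∷ (p +ₚ q)

  _*ₚ_ : Pol → Pol → Pol
  [] *ₚ q = []
  (a ∷ p) *ₚ q = map (a *_) q +ₚ (0# ∷ (p *ₚ q))

  _^ₚ_ : Pol → ℕ → Pol
  p ^ₚ zero = 1# ∷ []
  p ^ₚ ℕ.suc m = p *ₚ (p ^ₚ m)

  qInt : ℕ → Pol
  qInt n = replicate n 1#

  _∣ₚ_ : Pol → Pol → Set (c ⊔ ℓ)
  p ∣ₚ g = ∃ λ q → g ≈ₚ (p *ₚ q)

  -- Σ_{k ≡ j mod n} a_k k^r   (with k^r computed in ℕ, so 0^0 = 1),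
  -- where the list starts at index k.
  resSumFrom : (n : ℕ) .{{_ : NonZero n}} → ℕ → ℕ → ℕ → Pol → Carrier
  resSumFrom n j r k [] = 0#
  resSumFrom n j r k (a ∷ p) with k % n ℕ.≟ j
  ... | yes _ = (a * fromℕ (k ℕ.^ r)) + resSumFrom n j r (ℕ.suc k) p
  ... | no _  = resSumFrom n j r (ℕ.suc k) p

  resSum : (n : ℕ) .{{_ : NonZero n}} → Fin n → ℕ → Pol → Carrier
  resSum n j r g = resSumFrom n (toℕ j) r 0 g

record CharZeroField (c ℓ : Level) : Set (Level.suc (c ⊔ ℓ)) where
  field
    commutativeRing : CommutativeRing c ℓ
  open CommutativeRing commutativeRing public
  open Poly commutativeRing public
  field
    inverse : ∀ x → ¬ (x ≈ 0#) → ∃ λ y → (x * y) ≈ 1#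
    charZero : ∀ m → ¬ (fromℕ (ℕ.suc m) ≈ 0#)

-- Write θ = t d/dt; the sum of a_k k^r over k ≡ j (mod n) is then the j-th residue sum
-- σ_j (θ^r g) of coefficients.
-- (1) [n]_t ∣ f iff all σ_j f are equal. If f = q [n]_t, then t f = f + (t^n - 1) q,
--     whose residue sums are those of f, while multiplying by t rotates them. Conversely
--     f agrees modulo t^n - 1 with a polynomial of degree < n with the same residue sums,
--     i.e. with equal coefficients, i.e. a constant multiple of [n]_t.
-- (2) [n]_t^(l+1) ∣ g iff [n]_t ∣ θ^r g for all r ≤ l. By Leibniz, θ^r (Q^(k+r) q) is
--     Q^k (c (θQ)^r q + Q Y) with c a positive integer; this gives one direction, and the
--     other as well because θ[n]_t is a unit modulo [n]_t: (t - 1) θ[n]_t ≡ n (mod [n]_t).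
module Submission where

open import Level using (Level; _⊔_)
open import Algebra.Bundles using (CommutativeRing)
open import Algebra.Structures using (IsCommutativeRing)
import Algebra.Solver.Ring.AlmostCommutativeRing as ACR
open import Data.Nat as ℕ using (ℕ; zero; suc; NonZero; _%_; _≤_)
import Data.Nat.Properties as ℕP
open import Data.Nat.DivMod using ([m+n]%n≡m%n; %-distribˡ-+; m%n%n≡m%n; m<n⇒m%n≡m; m%n<n; n%n≡0)
import Data.Integer as ℤ
import Data.Integer.Properties as ℤP
open import Data.Fin using (Fin; toℕ; fromℕ<)
import Data.Fin.Properties as FinP
open import Data.List using (List; []; _∷_; map; take; drop; length; replicate)
import Data.List.Properties as LP
open import Data.Product using (_,_; ∃; ∃₂)
open import Data.Sum using (inj₁; inj₂)
open import Data.Maybe using (Maybe; just; nothing)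
open import Data.Empty.Irrelevant using () renaming (⊥-elim to ⊥-elim-irr)
open import Relation.Nullary using (yes; no; contradiction)
open import Relation.Binary.PropositionalEquality as ≡ using (_≡_)
open import Relation.Binary.Structures using (IsEquivalence)
import Relation.Binary.Reasoning.Setoid
open import Function.Bundles using (_⇔_; mk⇔; module Equivalence)
open import Function.Construct.Composition using (_⇔-∘_)
open Equivalence using (to; from)

open import Defs

module IntegerCoefficientSolver {c ℓ : Level} (R : CommutativeRing c ℓ) where
  open CommutativeRing R
  open ℤ using (ℤ; -[1+_]; _⊖_)
  open import Algebra.Properties.Ring ring
    using (-‿distribˡ-*; -‿distribʳ-*; -‿involutive; -0#≈0#; -‿anti-homo-+)
  open import Algebra.Properties.Semiring.Mult.TCOptimised semiring
    using (_×_; 1+×; ×-homo-+; ×1-homo-*)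
  open import Relation.Binary.Reasoning.Setoid setoid

  -- With the optimised _×_, fromℤ 0 and fromℤ 1 are 0# and 1# on the nose, so constants
  -- in solver equations match the ring's own 0# and 1#.
  fromℤ : ℤ → Carrier
  fromℤ (ℤ.+ n) = n × 1#
  fromℤ -[1+ n ] = - (suc n × 1#)

  private
    1+x-[1+y]≈x-y : ∀ x y → (1# + x) - (1# + y) ≈ x - y
    1+x-[1+y]≈x-y x y = begin
      (1# + x) - (1# + y)     ≈⟨ +-cong (+-comm 1# x) (-‿anti-homo-+ 1# y) ⟩
      (x + 1#) + (- y - 1#)   ≈⟨ +-assoc x 1# _ ⟩
      x + (1# + (- y - 1#))   ≈⟨ +-congˡ (+-comm 1# _) ⟩
      x + ((- y - 1#) + 1#)   ≈⟨ +-congˡ (+-assoc (- y) (- 1#) 1#) ⟩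
      x + (- y + (- 1# + 1#)) ≈⟨ +-congˡ (+-congˡ (-‿inverseˡ 1#)) ⟩
      x + (- y + 0#)          ≈⟨ +-congˡ (+-identityʳ (- y)) ⟩
      x - y                   ∎

  fromℤ-⊖ : ∀ m n → fromℤ (m ⊖ n) ≈ m × 1# - n × 1#
  fromℤ-⊖ zero zero = sym (trans (+-congˡ -0#≈0#) (+-identityʳ 0#))
  fromℤ-⊖ zero (suc n) = sym (+-identityˡ _)
  fromℤ-⊖ (suc m) zero = sym (trans (+-congˡ -0#≈0#) (+-identityʳ _))
  fromℤ-⊖ (suc m) (suc n) = begin
    fromℤ (suc m ⊖ suc n)           ≡⟨ ≡.cong fromℤ (ℤP.[1+m]⊖[1+n]≡m⊖n m n) ⟩
    fromℤ (m ⊖ n)                   ≈⟨ fromℤ-⊖ m n ⟩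
    m × 1# - n × 1#                 ≈⟨ 1+x-[1+y]≈x-y _ _ ⟨
    (1# + m × 1#) - (1# + n × 1#)   ≈⟨ +-cong (1+× m 1#) (-‿cong (1+× n 1#)) ⟨
    suc m × 1# - suc n × 1#         ∎

  fromℤ-homo-neg : ∀ i → fromℤ (ℤ.- i) ≈ - fromℤ i
  fromℤ-homo-neg (ℤ.+ zero) = sym -0#≈0#
  fromℤ-homo-neg (ℤ.+ suc n) = refl
  fromℤ-homo-neg -[1+ n ] = sym (-‿involutive _)

  fromℤ-homo-+ : ∀ i j → fromℤ (i ℤ.+ j) ≈ fromℤ i + fromℤ j
  fromℤ-homo-+ (ℤ.+ m) (ℤ.+ n) = ×-homo-+ 1# m n
  fromℤ-homo-+ (ℤ.+ m) -[1+ n ] = fromℤ-⊖ m (suc n)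
  fromℤ-homo-+ -[1+ m ] (ℤ.+ n) = trans (fromℤ-⊖ n (suc m)) (+-comm _ _)
  fromℤ-homo-+ -[1+ m ] -[1+ n ] = begin
    - (suc (suc (m ℕ.+ n)) × 1#)          ≡⟨ ≡.cong (λ k → - (suc k × 1#)) (ℕP.+-suc m n) ⟨
    - ((suc m ℕ.+ suc n) × 1#)            ≈⟨ -‿cong (×-homo-+ 1# (suc m) (suc n)) ⟩
    - (suc m × 1# + suc n × 1#)           ≈⟨ -‿anti-homo-+ _ _ ⟩
    - (suc n × 1#) - suc m × 1#           ≈⟨ +-comm _ _ ⟩
    - (suc m × 1#) - suc n × 1#           ∎

  fromℤ-pos-homo-* : ∀ m j → fromℤ (ℤ.+ m ℤ.* j) ≈ m × 1# * fromℤ j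
  fromℤ-pos-homo-* m (ℤ.+ n) rewrite ≡.sym (ℤP.pos-* m n) = ×1-homo-* m n
  fromℤ-pos-homo-* m -[1+ n ] = begin
    fromℤ (ℤ.+ m ℤ.* -[1+ n ])            ≡⟨ ≡.cong fromℤ (ℤP.neg-distribʳ-* (ℤ.+ m) (ℤ.+ suc n)) ⟨
    fromℤ (ℤ.- (ℤ.+ m ℤ.* ℤ.+ suc n))     ≈⟨ fromℤ-homo-neg (ℤ.+ m ℤ.* ℤ.+ suc n) ⟩
    - fromℤ (ℤ.+ m ℤ.* ℤ.+ suc n)         ≈⟨ -‿cong (fromℤ-pos-homo-* m (ℤ.+ suc n)) ⟩
    - (m × 1# * suc n × 1#)               ≈⟨ -‿distribʳ-* _ _ ⟩
    m × 1# * fromℤ -[1+ n ]               ∎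

  fromℤ-homo-* : ∀ i j → fromℤ (i ℤ.* j) ≈ fromℤ i * fromℤ j
  fromℤ-homo-* (ℤ.+ m) j = fromℤ-pos-homo-* m j
  fromℤ-homo-* -[1+ m ] j = begin
    fromℤ (-[1+ m ] ℤ.* j)                ≡⟨ ≡.cong fromℤ (ℤP.neg-distribˡ-* (ℤ.+ suc m) j) ⟨
    fromℤ (ℤ.- (ℤ.+ suc m ℤ.* j))         ≈⟨ fromℤ-homo-neg (ℤ.+ suc m ℤ.* j) ⟩
    - fromℤ (ℤ.+ suc m ℤ.* j)             ≈⟨ -‿cong (fromℤ-pos-homo-* (suc m) j) ⟩
    - (suc m × 1# * fromℤ j)              ≈⟨ -‿distribˡ-* _ _ ⟩
    fromℤ -[1+ m ] * fromℤ j              ∎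

  fromℤ-morphism : ℤ.+-*-rawRing ACR.-Raw-AlmostCommutative⟶ ACR.fromCommutativeRing R
  fromℤ-morphism = record
    { ⟦_⟧ = fromℤ
    ; +-homo = fromℤ-homo-+
    ; *-homo = fromℤ-homo-*
    ; -‿homo = fromℤ-homo-neg
    ; 0-homo = refl
    ; 1-homo = refl
    }

  fromℤ-≟ : ∀ i j → Maybe (fromℤ i ≈ fromℤ j)
  fromℤ-≟ i j with i ℤP.≟ j
  ... | yes ≡.refl = just refl
  ... | no _ = nothing

  open import Algebra.Solver.Ring ℤ.+-*-rawRing (ACR.fromCommutativeRing R) fromℤ-morphism fromℤ-≟ public

  𝟘 𝟙 : ∀ {m} → Polynomial m
  𝟘 = con (ℤ.+ 0)
  𝟙 = con (ℤ.+ 1)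

module RingDivisibility {c ℓ : Level} (R : CommutativeRing c ℓ) where
  open CommutativeRing R
  open IntegerCoefficientSolver R using (solve; _:+_; _:*_; _:-_; _:=_; 𝟘; 𝟙)
  open import Algebra.Properties.CommutativeSemigroup.Divisibility *-commutativeSemigroup public
  open import Relation.Binary.Reasoning.Setoid setoid

  ∣-+ : ∀ {x y z} → x ∣ y → x ∣ z → x ∣ y + z
  ∣-+ {x} (a , ax≈y) (b , bx≈z) = a + b , trans (distribʳ x a b) (+-cong ax≈y bx≈z)

  ∣-- : ∀ {x y z} → x ∣ y → x ∣ z → x ∣ y - z
  ∣-- {x} (a , ax≈y) (b , bx≈z) = a - b , trans ([y-z]x≈yx-zx x a b) (+-cong ax≈y (-‿cong bx≈z))
    where open import Algebra.Properties.Ring ring using ([y-z]x≈yx-zx)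

  UnitModulo : Carrier → Carrier → Set (c ⊔ ℓ)
  UnitModulo x a = ∃₂ λ u w → u * a ≈ 1# + w * x

  unitModulo-∣-cancel : ∀ {x a y} → UnitModulo x a → x ∣ a * y → x ∣ y
  unitModulo-∣-cancel {x} {a} {y} (u , w , ua≈1+wx) (q , qx≈ay) = u * q - w * y , (begin
    (u * q - w * y) * x        ≈⟨ solve 5 (λ u q w y x → (u :* q :- w :* y) :* x := u :* (q :* x) :- w :* x :* y) refl u q w y x ⟩
    u * (q * x) - w * x * y    ≈⟨ +-congʳ (*-congˡ qx≈ay) ⟩
    u * (a * y) - w * x * y    ≈⟨ +-congʳ (*-assoc u a y) ⟨
    (u * a) * y - w * x * y    ≈⟨ +-congʳ (*-congʳ ua≈1+wx) ⟩
    (1# + w * x) * y - w * x * y ≈⟨ solve 3 (λ w x y → (𝟙 :+ w :* x) :* y :- w :* x :* y := y) refl w x y ⟩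
    y                          ∎)

module PolynomialRing {c ℓ : Level} (R : CommutativeRing c ℓ) where
  open CommutativeRing R
  open Poly R
  open import Algebra.Properties.Ring ring using (-0#≈0#)
  open import Algebra.Properties.CommutativeSemigroup +-commutativeSemigroup
    using () renaming (interchange to +-interchange; x∙yz≈y∙xz to x+[y+z]≈y+[x+z])
  private module ≈-Reasoning = Relation.Binary.Reasoning.Setoid setoid

  -- _≈ₚ_ is a function type, so its two sides cannot be inferred from it; the record can.
  infix 4 _≋_
  record _≋_ (p q : Pol) : Set ℓ where
    constructor mk≋
    field coeff-≈ : p ≈ₚ q
  open _≋_ public

  negₚ : Pol → Pol
  negₚ = map (-_)

  ≋-isEquivalence : IsEquivalence _≋_
  ≋-isEquivalence = record
    { refl = mk≋ λ _ → refl
    ; sym = λ e → mk≋ λ k → sym (coeff-≈ e k)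
    ; trans = λ e f → mk≋ λ k → trans (coeff-≈ e k) (coeff-≈ f k)
    }

  open IsEquivalence ≋-isEquivalence public
    using () renaming (refl to ≋-refl; sym to ≋-sym; trans to ≋-trans)

  ≡⇒≋ : ∀ {p q} → p ≡ q → p ≋ q
  ≡⇒≋ ≡.refl = ≋-refl

  ∷-cong : ∀ {a b p q} → a ≈ b → p ≋ q → a ∷ p ≋ b ∷ q
  ∷-cong a≈b p≋q = mk≋ λ { zero → a≈b ; (suc k) → coeff-≈ p≋q k }

  coeff-+ₚ : ∀ p q k → coeff (p +ₚ q) k ≈ coeff p k + coeff q k
  coeff-+ₚ [] q k = sym (+-identityˡ _)
  coeff-+ₚ (a ∷ p) [] k = sym (+-identityʳ _)
  coeff-+ₚ (a ∷ p) (b ∷ q) zero = refl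
  coeff-+ₚ (a ∷ p) (b ∷ q) (suc k) = coeff-+ₚ p q k

  coeff-scale : ∀ a p k → coeff (map (a *_) p) k ≈ a * coeff p k
  coeff-scale a [] k = sym (zeroʳ a)
  coeff-scale a (b ∷ p) zero = refl
  coeff-scale a (b ∷ p) (suc k) = coeff-scale a p k

  coeff-negₚ : ∀ p k → coeff (negₚ p) k ≈ - coeff p k
  coeff-negₚ [] k = sym -0#≈0#
  coeff-negₚ (b ∷ p) zero = refl
  coeff-negₚ (b ∷ p) (suc k) = coeff-negₚ p k

  coeff-*ₚ-∷ : ∀ a p q k → coeff ((a ∷ p) *ₚ q) k ≈ a * coeff q k + coeff (0# ∷ p *ₚ q) k
  coeff-*ₚ-∷ a p q k = trans (coeff-+ₚ (map (a *_) q) (0# ∷ p *ₚ q) k) (+-congʳ (coeff-scale a q k))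

  0∷[]≋[] : 0# ∷ [] ≋ []
  0∷[]≋[] = mk≋ λ { zero → refl ; (suc k) → refl }

  +ₚ-cong : ∀ {p p' q q'} → p ≋ p' → q ≋ q' → p +ₚ q ≋ p' +ₚ q'
  +ₚ-cong {p} {p'} {q} {q'} e f = mk≋ λ k →
    trans (coeff-+ₚ p q k) (trans (+-cong (coeff-≈ e k) (coeff-≈ f k)) (sym (coeff-+ₚ p' q' k)))

  scale-cong : ∀ {a b p q} → a ≈ b → p ≋ q → map (a *_) p ≋ map (b *_) q
  scale-cong {a} {b} {p} {q} a≈b e = mk≋ λ k →
    trans (coeff-scale a p k) (trans (*-cong a≈b (coeff-≈ e k)) (sym (coeff-scale b q k)))

  negₚ-cong : ∀ {p q} → p ≋ q → negₚ p ≋ negₚ q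
  negₚ-cong {p} {q} e = mk≋ λ k →
    trans (coeff-negₚ p k) (trans (-‿cong (coeff-≈ e k)) (sym (coeff-negₚ q k)))

  +ₚ-assoc : ∀ p q r → (p +ₚ q) +ₚ r ≋ p +ₚ (q +ₚ r)
  +ₚ-assoc p q r = mk≋ λ k → begin
    coeff ((p +ₚ q) +ₚ r) k              ≈⟨ trans (coeff-+ₚ (p +ₚ q) r k) (+-congʳ (coeff-+ₚ p q k)) ⟩
    (coeff p k + coeff q k) + coeff r k  ≈⟨ +-assoc _ _ _ ⟩
    coeff p k + (coeff q k + coeff r k)  ≈⟨ trans (coeff-+ₚ p (q +ₚ r) k) (+-congˡ (coeff-+ₚ q r k)) ⟨
    coeff (p +ₚ (q +ₚ r)) k              ∎
    where open ≈-Reasoning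

  +ₚ-comm : ∀ p q → p +ₚ q ≋ q +ₚ p
  +ₚ-comm p q = mk≋ λ k → trans (coeff-+ₚ p q k) (trans (+-comm _ _) (sym (coeff-+ₚ q p k)))

  +ₚ-identityʳ : ∀ p → p +ₚ [] ≋ p
  +ₚ-identityʳ p = mk≋ λ k → trans (coeff-+ₚ p [] k) (+-identityʳ _)

  negₚ-inverseˡ : ∀ p → negₚ p +ₚ p ≋ []
  negₚ-inverseˡ p = mk≋ λ k →
    trans (coeff-+ₚ (negₚ p) p k) (trans (+-congʳ (coeff-negₚ p k)) (-‿inverseˡ _))

  negₚ-inverseʳ : ∀ p → p +ₚ negₚ p ≋ []
  negₚ-inverseʳ p = ≋-trans (+ₚ-comm p (negₚ p)) (negₚ-inverseˡ p)

  ≋-tail : ∀ {a p} q → a ∷ p ≋ q → p ≋ drop 1 q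
  ≋-tail [] e = mk≋ λ k → coeff-≈ e (suc k)
  ≋-tail (b ∷ q) e = mk≋ λ k → coeff-≈ e (suc k)

  scale-zero : ∀ {a} q → a ≈ 0# → map (a *_) q ≋ []
  scale-zero {a} q a≈0 = mk≋ λ k → trans (coeff-scale a q k) (trans (*-congʳ a≈0) (zeroˡ _))

  *ₚ-zeroˡ : ∀ {p} q → p ≋ [] → p *ₚ q ≋ []
  *ₚ-zeroˡ {[]} q _ = ≋-refl
  *ₚ-zeroˡ {a ∷ p} q e =
    ≋-trans (+ₚ-cong (scale-zero q (coeff-≈ e 0)) (∷-cong refl (*ₚ-zeroˡ q (≋-tail [] e)))) 0∷[]≋[]

  *ₚ-zeroʳ : ∀ p → p *ₚ [] ≋ []
  *ₚ-zeroʳ [] = ≋-refl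
  *ₚ-zeroʳ (a ∷ p) = ≋-trans (∷-cong refl (*ₚ-zeroʳ p)) 0∷[]≋[]

  *ₚ-congˡ : ∀ {p p'} q → p ≋ p' → p *ₚ q ≋ p' *ₚ q
  *ₚ-congˡ {[]} q e = ≋-sym (*ₚ-zeroˡ q (≋-sym e))
  *ₚ-congˡ {a ∷ p} {[]} q e = *ₚ-zeroˡ q e
  *ₚ-congˡ {a ∷ p} {a' ∷ p'} q e =
    +ₚ-cong (scale-cong (coeff-≈ e 0) ≋-refl) (∷-cong refl (*ₚ-congˡ q (≋-tail (a' ∷ p') e)))

  *ₚ-congʳ : ∀ p {q q'} → q ≋ q' → p *ₚ q ≋ p *ₚ q'
  *ₚ-congʳ [] e = ≋-refl
  *ₚ-congʳ (a ∷ p) e = +ₚ-cong (scale-cong refl e) (∷-cong refl (*ₚ-congʳ p e))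

  *ₚ-distribʳ : ∀ r p q → (p +ₚ q) *ₚ r ≋ (p *ₚ r) +ₚ (q *ₚ r)
  *ₚ-distribʳ r [] q = ≋-refl
  *ₚ-distribʳ r (a ∷ p) [] = ≋-sym (+ₚ-identityʳ _)
  *ₚ-distribʳ r (a ∷ p) (b ∷ q) = mk≋ coeffs
    where
    open ≈-Reasoning
    coeffs : (((a + b) ∷ (p +ₚ q)) *ₚ r) ≈ₚ (((a ∷ p) *ₚ r) +ₚ ((b ∷ q) *ₚ r))
    coeffs k = begin
      coeff (((a + b) ∷ (p +ₚ q)) *ₚ r) k
        ≈⟨ coeff-*ₚ-∷ (a + b) (p +ₚ q) r k ⟩
      (a + b) * x + coeff (0# ∷ (p +ₚ q) *ₚ r) k
        ≈⟨ +-congˡ (coeff-≈ (∷-cong (sym (+-identityʳ 0#)) (*ₚ-distribʳ r p q)) k) ⟩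
      (a + b) * x + coeff ((0# ∷ p *ₚ r) +ₚ (0# ∷ q *ₚ r)) k
        ≈⟨ +-congˡ (coeff-+ₚ (0# ∷ p *ₚ r) (0# ∷ q *ₚ r) k) ⟩
      (a + b) * x + (y + z)
        ≈⟨ +-congʳ (distribʳ x a b) ⟩
      (a * x + b * x) + (y + z)
        ≈⟨ +-interchange _ _ _ _ ⟩
      (a * x + y) + (b * x + z)
        ≈⟨ +-cong (coeff-*ₚ-∷ a p r k) (coeff-*ₚ-∷ b q r k) ⟨
      coeff ((a ∷ p) *ₚ r) k + coeff ((b ∷ q) *ₚ r) k
        ≈⟨ coeff-+ₚ ((a ∷ p) *ₚ r) ((b ∷ q) *ₚ r) k ⟨
      coeff (((a ∷ p) *ₚ r) +ₚ ((b ∷ q) *ₚ r)) k ∎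
      where
      x = coeff r k
      y = coeff (0# ∷ p *ₚ r) k
      z = coeff (0# ∷ q *ₚ r) k

  *ₚ-∷ʳ : ∀ p b q → p *ₚ (b ∷ q) ≋ map (b *_) p +ₚ (0# ∷ p *ₚ q)
  *ₚ-∷ʳ [] b q = ≋-sym 0∷[]≋[]
  *ₚ-∷ʳ (a ∷ p) b q = mk≋ coeffs
    where
    open ≈-Reasoning
    coeffs : ((a ∷ p) *ₚ (b ∷ q)) ≈ₚ (map (b *_) (a ∷ p) +ₚ (0# ∷ (a ∷ p) *ₚ q))
    coeffs zero = +-cong (*-comm a b) refl
    coeffs (suc k) = begin
      coeff (map (a *_) q +ₚ (p *ₚ (b ∷ q))) k
        ≈⟨ coeff-+ₚ (map (a *_) q) (p *ₚ (b ∷ q)) k ⟩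
      coeff (map (a *_) q) k + coeff (p *ₚ (b ∷ q)) k
        ≈⟨ +-cong (coeff-scale a q k) (coeff-≈ (*ₚ-∷ʳ p b q) k) ⟩
      a * coeff q k + coeff (map (b *_) p +ₚ (0# ∷ p *ₚ q)) k
        ≈⟨ +-congˡ (trans (coeff-+ₚ (map (b *_) p) (0# ∷ p *ₚ q) k) (+-congʳ (coeff-scale b p k))) ⟩
      a * coeff q k + (b * coeff p k + coeff (0# ∷ p *ₚ q) k)
        ≈⟨ x+[y+z]≈y+[x+z] _ _ _ ⟩
      b * coeff p k + (a * coeff q k + coeff (0# ∷ p *ₚ q) k)
        ≈⟨ +-cong (coeff-scale b p k) (coeff-*ₚ-∷ a p q k) ⟨
      coeff (map (b *_) p) k + coeff ((a ∷ p) *ₚ q) k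
        ≈⟨ coeff-+ₚ (map (b *_) p) ((a ∷ p) *ₚ q) k ⟨
      coeff (map (b *_) p +ₚ ((a ∷ p) *ₚ q)) k ∎

  *ₚ-comm : ∀ p q → p *ₚ q ≋ q *ₚ p
  *ₚ-comm [] q = ≋-sym (*ₚ-zeroʳ q)
  *ₚ-comm (a ∷ p) q = ≋-trans (+ₚ-cong ≋-refl (∷-cong refl (*ₚ-comm p q))) (≋-sym (*ₚ-∷ʳ q a p))

  scale-*ₚ : ∀ a q r → map (a *_) q *ₚ r ≋ map (a *_) (q *ₚ r)
  scale-*ₚ a [] r = ≋-refl
  scale-*ₚ a (b ∷ q) r = mk≋ λ k → begin
    coeff (((a * b) ∷ map (a *_) q) *ₚ r) k
      ≈⟨ coeff-*ₚ-∷ (a * b) (map (a *_) q) r k ⟩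
    (a * b) * coeff r k + coeff (0# ∷ map (a *_) q *ₚ r) k
      ≈⟨ +-cong (*-assoc a b _) (coeff-≈ (∷-cong (sym (zeroʳ a)) (scale-*ₚ a q r)) k) ⟩
    a * (b * coeff r k) + coeff (map (a *_) (0# ∷ q *ₚ r)) k
      ≈⟨ +-congˡ (coeff-scale a (0# ∷ q *ₚ r) k) ⟩
    a * (b * coeff r k) + a * coeff (0# ∷ q *ₚ r) k
      ≈⟨ distribˡ a _ _ ⟨
    a * (b * coeff r k + coeff (0# ∷ q *ₚ r) k)
      ≈⟨ trans (coeff-scale a ((b ∷ q) *ₚ r) k) (*-congˡ (coeff-*ₚ-∷ b q r k)) ⟨
    coeff (map (a *_) ((b ∷ q) *ₚ r)) k ∎
    where open ≈-Reasoning

  0∷-*ₚ : ∀ p r → (0# ∷ p) *ₚ r ≋ 0# ∷ p *ₚ r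
  0∷-*ₚ p r = +ₚ-cong (scale-zero r refl) ≋-refl

  *ₚ-assoc : ∀ p q r → (p *ₚ q) *ₚ r ≋ p *ₚ (q *ₚ r)
  *ₚ-assoc [] q r = ≋-refl
  *ₚ-assoc (a ∷ p) q r = ≋-trans (*ₚ-distribʳ r (map (a *_) q) (0# ∷ p *ₚ q))
    (+ₚ-cong (scale-*ₚ a q r) (≋-trans (0∷-*ₚ (p *ₚ q) r) (∷-cong refl (*ₚ-assoc p q r))))

  *ₚ-identityˡ : ∀ p → (1# ∷ []) *ₚ p ≋ p
  *ₚ-identityˡ p = ≋-trans (+ₚ-cong (mk≋ λ k → trans (coeff-scale 1# p k) (*-identityˡ _)) 0∷[]≋[]) (+ₚ-identityʳ p)

  *ₚ-distribˡ : ∀ r p q → r *ₚ (p +ₚ q) ≋ (r *ₚ p) +ₚ (r *ₚ q)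
  *ₚ-distribˡ r p q = ≋-trans (*ₚ-comm r (p +ₚ q))
    (≋-trans (*ₚ-distribʳ r p q) (+ₚ-cong (*ₚ-comm p r) (*ₚ-comm q r)))

  length-+ₚ : ∀ p q → length (p +ₚ q) ≡ length p ℕ.⊔ length q
  length-+ₚ [] q = ≡.refl
  length-+ₚ (a ∷ p) [] = ≡.refl
  length-+ₚ (a ∷ p) (b ∷ q) = ≡.cong suc (length-+ₚ p q)

  coeff-≥length : ∀ p {i} → length p ℕ.≤ i → coeff p i ≡ 0#
  coeff-≥length [] _ = ≡.refl
  coeff-≥length (a ∷ p) (ℕ.s≤s bound) = coeff-≥length p bound

  coeff-replicate : ∀ m a {i} → i ℕ.< m → coeff (replicate m a) i ≡ a
  coeff-replicate (suc m) a {zero} _ = ≡.refl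
  coeff-replicate (suc m) a {suc i} (ℕ.s≤s i<m) = coeff-replicate m a i<m

  infixl 6 _⊕_
  infixl 7 _⊗_
  infix 8 ⊝_

  -- Opaque, so that unification cannot unfold them and the implicit arguments of
  -- the ring laws below stay inferable.
  opaque
    _⊕_ : Pol → Pol → Pol
    _⊕_ = _+ₚ_

    _⊗_ : Pol → Pol → Pol
    _⊗_ = _*ₚ_

    ⊝_ : Pol → Pol
    ⊝_ = negₚ

  opaque
    unfolding _⊕_ _⊗_ ⊝_

    ⊕≡+ₚ : ∀ p q → p ⊕ q ≡ p +ₚ q
    ⊕≡+ₚ p q = ≡.refl

    ⊗≡*ₚ : ∀ p q → p ⊗ q ≡ p *ₚ q
    ⊗≡*ₚ p q = ≡.refl

    ⊝≡negₚ : ∀ p → ⊝ p ≡ negₚ p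
    ⊝≡negₚ p = ≡.refl

    ⊕-⊗-isCommutativeRing : IsCommutativeRing _≋_ _⊕_ _⊗_ ⊝_ [] (1# ∷ [])
    ⊕-⊗-isCommutativeRing = record
      { isRing = record
        { +-isAbelianGroup = record
          { isGroup = record
            { isMonoid = record
              { isSemigroup = record
                { isMagma = record { isEquivalence = ≋-isEquivalence ; ∙-cong = +ₚ-cong }
                ; assoc = +ₚ-assoc
                }
              ; identity = (λ _ → ≋-refl) , +ₚ-identityʳ
              }
            ; inverse = negₚ-inverseˡ , negₚ-inverseʳ
            ; ⁻¹-cong = negₚ-cong
            }
          ; comm = +ₚ-comm
          }
        ; *-cong = λ {p} {p'} {q} e f → ≋-trans (*ₚ-congˡ q e) (*ₚ-congʳ p' f)
        ; *-assoc = *ₚ-assoc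
        ; *-identity = *ₚ-identityˡ , λ p → ≋-trans (*ₚ-comm p _) (*ₚ-identityˡ p)
        ; distrib = *ₚ-distribˡ , *ₚ-distribʳ
        }
      ; *-comm = *ₚ-comm
      }

  ⊕-⊗-commutativeRing : CommutativeRing c ℓ
  ⊕-⊗-commutativeRing = record { isCommutativeRing = ⊕-⊗-isCommutativeRing }

  open CommutativeRing ⊕-⊗-commutativeRing public using ()
    renaming (_-_ to infixl 6 _⊖_; 0# to 0ₚ; 1# to 1ₚ)

  coeff-⊕ : ∀ p q k → coeff (p ⊕ q) k ≈ coeff p k + coeff q k
  coeff-⊕ p q k rewrite ⊕≡+ₚ p q = coeff-+ₚ p q k

  coeff-⊝ : ∀ p k → coeff (⊝ p) k ≈ - coeff p k
  coeff-⊝ p k rewrite ⊝≡negₚ p = coeff-negₚ p k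

  C : Carrier → Pol
  C a = a ∷ []

  t : Pol
  t = 0# ∷ 1# ∷ []

  C-⊗ : ∀ a p → C a ⊗ p ≋ map (a *_) p
  C-⊗ a p rewrite ⊗≡*ₚ (C a) p = ≋-trans (+ₚ-cong ≋-refl 0∷[]≋[]) (+ₚ-identityʳ (map (a *_) p))

  t-⊗ : ∀ p → t ⊗ p ≋ 0# ∷ p
  t-⊗ p rewrite ⊗≡*ₚ t p = ≋-trans (0∷-*ₚ (1# ∷ []) p) (∷-cong refl (*ₚ-identityˡ p))

  C-cong : ∀ {a b} → a ≈ b → C a ≋ C b
  C-cong a≈b = ∷-cong a≈b ≋-refl

  C-+ : ∀ a b → C (a + b) ≋ C a ⊕ C b
  C-+ a b rewrite ⊕≡+ₚ (C a) (C b) = ≋-refl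

  C-* : ∀ a b → C (a * b) ≋ C a ⊗ C b
  C-* a b = ≋-sym (C-⊗ a (C b))

  ^ₚ-suc : ∀ p m → p ^ₚ suc m ≋ p ⊗ p ^ₚ m
  ^ₚ-suc p m rewrite ⊗≡*ₚ p (p ^ₚ m) = ≋-refl

  ∷-≋ : ∀ a p → a ∷ p ≋ C a ⊕ t ⊗ p
  ∷-≋ a p = mk≋ λ k → sym (trans (coeff-⊕ (C a) (t ⊗ p) k) (trans (+-congˡ (coeff-≈ (t-⊗ p) k)) (lemma k)))
    where
    lemma : ∀ k → coeff (C a) k + coeff (0# ∷ p) k ≈ coeff (a ∷ p) k
    lemma zero = +-identityʳ a
    lemma (suc k) = +-identityˡ _

  private
    module P = CommutativeRing ⊕-⊗-commutativeRing
    module ≋-Reasoning = Relation.Binary.Reasoning.Setoid P.setoid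
  open IntegerCoefficientSolver ⊕-⊗-commutativeRing using (solve; _:+_; _:*_; _:-_; _:=_; 𝟘; 𝟙)

  [t-1]⊗qInt : ∀ n → (t ⊖ 1ₚ) ⊗ qInt n ≋ t ^ₚ n ⊖ 1ₚ
  [t-1]⊗qInt zero = solve 1 (λ t → (t :- 𝟙) :* 𝟘 := 𝟙 :- 𝟙) P.refl t
  [t-1]⊗qInt (suc n) = begin
    (t ⊖ 1ₚ) ⊗ (1# ∷ qInt n)              ≈⟨ P.*-congˡ (∷-≋ 1# (qInt n)) ⟩
    (t ⊖ 1ₚ) ⊗ (1ₚ ⊕ t ⊗ qInt n)
      ≈⟨ solve 2 (λ t q → (t :- 𝟙) :* (𝟙 :+ t :* q) := (t :- 𝟙) :+ t :* ((t :- 𝟙) :* q)) P.refl t (qInt n) ⟩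
    (t ⊖ 1ₚ) ⊕ t ⊗ ((t ⊖ 1ₚ) ⊗ qInt n)    ≈⟨ P.+-congˡ (P.*-congˡ ([t-1]⊗qInt n)) ⟩
    (t ⊖ 1ₚ) ⊕ t ⊗ (t ^ₚ n ⊖ 1ₚ)          ≈⟨ solve 2 (λ t x → (t :- 𝟙) :+ t :* (x :- 𝟙) := t :* x :- 𝟙) P.refl t (t ^ₚ n) ⟩
    t ⊗ t ^ₚ n ⊖ 1ₚ                        ≈⟨ P.+-congʳ (^ₚ-suc t n) ⟨
    t ^ₚ suc n ⊖ 1ₚ                        ∎
    where open ≋-Reasoning

  take⊕drop : ∀ m f → f ≋ take m f ⊕ t ^ₚ m ⊗ drop m f
  take⊕drop zero f = ≋-sym (≋-trans (P.+-identityˡ _) (P.*-identityˡ f))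
  take⊕drop (suc m) [] = solve 1 (λ x → 𝟘 := 𝟘 :+ x :* 𝟘) P.refl (t ^ₚ suc m)
  take⊕drop (suc m) (a ∷ f) = begin
    a ∷ f                                          ≈⟨ ∷-≋ a f ⟩
    C a ⊕ t ⊗ f                                    ≈⟨ P.+-congˡ (P.*-congˡ (take⊕drop m f)) ⟩
    C a ⊕ t ⊗ (take m f ⊕ t ^ₚ m ⊗ drop m f)
      ≈⟨ solve 5 (λ c t x y z → c :+ t :* (x :+ y :* z) := (c :+ t :* x) :+ (t :* y) :* z) P.refl (C a) t (take m f) (t ^ₚ m) (drop m f) ⟩
    (C a ⊕ t ⊗ take m f) ⊕ (t ⊗ t ^ₚ m) ⊗ drop m f ≈⟨ P.+-cong (∷-≋ a (take m f)) (P.*-congʳ (^ₚ-suc t m)) ⟨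
    (a ∷ take m f) ⊕ t ^ₚ suc m ⊗ drop m f         ∎
    where open ≋-Reasoning

  open RingDivisibility ⊕-⊗-commutativeRing using (_∣_; _,_)

  ∣ₚ⇔∣ : ∀ {p g} → p ∣ₚ g ⇔ p ∣ g
  ∣ₚ⇔∣ {p} {g} = mk⇔
    (λ (q , g≈p*q) → q , ≋-trans (P.*-comm q p) (≋-trans (≡⇒≋ (⊗≡*ₚ p q)) (≋-sym (mk≋ g≈p*q))))
    (λ (q , q⊗p≋g) → q , coeff-≈ (≋-trans (≋-sym q⊗p≋g) (≋-trans (P.*-comm q p) (≡⇒≋ (⊗≡*ₚ p q)))))

module EulerOperator {c ℓ : Level} (R : CommutativeRing c ℓ) where
  open CommutativeRing R
  open Poly R
  open PolynomialRing R
  private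
    module P = CommutativeRing ⊕-⊗-commutativeRing
    module ≈-Reasoning = Relation.Binary.Reasoning.Setoid setoid
    module ≋-Reasoning = Relation.Binary.Reasoning.Setoid P.setoid
  open IntegerCoefficientSolver ⊕-⊗-commutativeRing using (solve; _:+_; _:*_; _:-_; _:=_; 𝟘; 𝟙)
  open import Algebra.Properties.Semiring.Mult semiring using (_×_; ×1-homo-*)
  open RingDivisibility ⊕-⊗-commutativeRing using (_∣_; _,_)

  -- θ = t d/dt, which multiplies the coefficient of t^k by k.
  θ : Pol → Pol
  θ [] = []
  θ (a ∷ p) = 0# ∷ (θ p +ₚ p)

  coeff-θ : ∀ p k → coeff (θ p) k ≈ fromℕ k * coeff p k
  coeff-θ [] k = sym (zeroʳ _)
  coeff-θ (a ∷ p) zero = sym (zeroˡ _)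
  coeff-θ (a ∷ p) (suc k) = begin
    coeff (θ p +ₚ p) k                   ≈⟨ coeff-+ₚ (θ p) p k ⟩
    coeff (θ p) k + coeff p k            ≈⟨ +-cong (coeff-θ p k) (sym (*-identityˡ _)) ⟩
    fromℕ k * coeff p k + 1# * coeff p k ≈⟨ +-comm _ _ ⟩
    1# * coeff p k + fromℕ k * coeff p k ≈⟨ distribʳ _ _ _ ⟨
    (1# + fromℕ k) * coeff p k           ∎
    where open ≈-Reasoning

  θ-cong : ∀ {p q} → p ≋ q → θ p ≋ θ q
  θ-cong {p} {q} e = mk≋ λ k → trans (coeff-θ p k) (trans (*-congˡ (coeff-≈ e k)) (sym (coeff-θ q k)))

  θ-⊕ : ∀ p q → θ (p ⊕ q) ≋ θ p ⊕ θ q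
  θ-⊕ p q = mk≋ λ k → begin
    coeff (θ (p ⊕ q)) k                          ≈⟨ coeff-θ (p ⊕ q) k ⟩
    fromℕ k * coeff (p ⊕ q) k                    ≈⟨ *-congˡ (coeff-⊕ p q k) ⟩
    fromℕ k * (coeff p k + coeff q k)            ≈⟨ distribˡ _ _ _ ⟩
    fromℕ k * coeff p k + fromℕ k * coeff q k    ≈⟨ +-cong (coeff-θ p k) (coeff-θ q k) ⟨
    coeff (θ p) k + coeff (θ q) k                ≈⟨ coeff-⊕ (θ p) (θ q) k ⟨
    coeff (θ p ⊕ θ q) k                          ∎
    where open ≈-Reasoning

  θ-⊝ : ∀ p → θ (⊝ p) ≋ ⊝ θ p
  θ-⊝ p = mk≋ λ k → begin
    coeff (θ (⊝ p)) k         ≈⟨ trans (coeff-θ (⊝ p) k) (*-congˡ (coeff-⊝ p k)) ⟩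
    fromℕ k * - coeff p k     ≈⟨ -‿distribʳ-* _ _ ⟨
    - (fromℕ k * coeff p k)   ≈⟨ trans (coeff-⊝ (θ p) k) (-‿cong (coeff-θ p k)) ⟨
    coeff (⊝ θ p) k           ∎
    where
    open ≈-Reasoning
    open import Algebra.Properties.Ring ring using (-‿distribʳ-*)

  θ-⊖ : ∀ p q → θ (p ⊖ q) ≋ θ p ⊖ θ q
  θ-⊖ p q = ≋-trans (θ-⊕ p (⊝ q)) (P.+-congˡ (θ-⊝ q))

  θ-scale : ∀ a p → θ (map (a *_) p) ≋ map (a *_) (θ p)
  θ-scale a p = mk≋ λ k → begin
    coeff (θ (map (a *_) p)) k         ≈⟨ trans (coeff-θ (map (a *_) p) k) (*-congˡ (coeff-scale a p k)) ⟩
    fromℕ k * (a * coeff p k)          ≈⟨ x∙yz≈y∙xz _ _ _ ⟩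
    a * (fromℕ k * coeff p k)          ≈⟨ trans (coeff-scale a (θ p) k) (*-congˡ (coeff-θ p k)) ⟨
    coeff (map (a *_) (θ p)) k         ∎
    where
    open ≈-Reasoning
    open import Algebra.Properties.CommutativeSemigroup *-commutativeSemigroup using (x∙yz≈y∙xz)

  θ-C⊗ : ∀ a p → θ (C a ⊗ p) ≋ C a ⊗ θ p
  θ-C⊗ a p = ≋-trans (θ-cong (C-⊗ a p)) (≋-trans (θ-scale a p) (≋-sym (C-⊗ a (θ p))))

  θ-C : ∀ a → θ (C a) ≋ 0ₚ
  θ-C a = 0∷[]≋[]

  θ-t : θ t ≋ t
  θ-t = ∷-cong refl (∷-cong (+-identityˡ 1#) ≋-refl)

  θ-∷ : ∀ a p → θ (a ∷ p) ≋ t ⊗ (θ p ⊕ p)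
  θ-∷ a p = ≋-sym (≋-trans (t-⊗ (θ p ⊕ p)) (∷-cong refl (≡⇒≋ (⊕≡+ₚ (θ p) p))))

  θ-leibniz : ∀ p q → θ (p ⊗ q) ≋ θ p ⊗ q ⊕ p ⊗ θ q
  θ-leibniz [] q = begin
    θ (0ₚ ⊗ q)              ≈⟨ θ-cong (P.zeroˡ q) ⟩
    0ₚ                      ≈⟨ solve 2 (λ q θq → 𝟘 := 𝟘 :* q :+ 𝟘 :* θq) P.refl q (θ q) ⟩
    0ₚ ⊗ q ⊕ 0ₚ ⊗ θ q       ∎
    where open ≋-Reasoning
  θ-leibniz (a ∷ p) q = begin
    θ ((a ∷ p) ⊗ q)                            ≈⟨ θ-cong (P.*-congʳ (∷-≋ a p)) ⟩
    θ ((C a ⊕ t ⊗ p) ⊗ q)                      ≈⟨ θ-cong (solve 4 (λ A t p q → (A :+ t :* p) :* q := A :* q :+ t :* (p :* q)) P.refl (C a) t p q) ⟩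
    θ (C a ⊗ q ⊕ t ⊗ (p ⊗ q))                  ≈⟨ θ-⊕ (C a ⊗ q) (t ⊗ (p ⊗ q)) ⟩
    θ (C a ⊗ q) ⊕ θ (t ⊗ (p ⊗ q))              ≈⟨ P.+-cong (θ-C⊗ a q) (θ-cong (t-⊗ (p ⊗ q))) ⟩
    C a ⊗ θ q ⊕ θ (0# ∷ p ⊗ q)                 ≈⟨ P.+-congˡ (θ-∷ 0# (p ⊗ q)) ⟩
    C a ⊗ θ q ⊕ t ⊗ (θ (p ⊗ q) ⊕ p ⊗ q)        ≈⟨ P.+-congˡ (P.*-congˡ (P.+-congʳ (θ-leibniz p q))) ⟩
    C a ⊗ θ q ⊕ t ⊗ ((θ p ⊗ q ⊕ p ⊗ θ q) ⊕ p ⊗ q)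
      ≈⟨ solve 6 (λ A θq t θp q p → A :* θq :+ t :* ((θp :* q :+ p :* θq) :+ p :* q)
                                  := (t :* (θp :+ p)) :* q :+ (A :+ t :* p) :* θq) P.refl (C a) (θ q) t (θ p) q p ⟩
    (t ⊗ (θ p ⊕ p)) ⊗ q ⊕ (C a ⊕ t ⊗ p) ⊗ θ q  ≈⟨ P.+-cong (P.*-congʳ (θ-∷ a p)) (P.*-congʳ (∷-≋ a p)) ⟨
    θ (a ∷ p) ⊗ q ⊕ (a ∷ p) ⊗ θ q              ∎
    where open ≋-Reasoning

  θ-^ : ∀ p m → θ (p ^ₚ suc m) ≋ C (fromℕ (suc m)) ⊗ p ^ₚ m ⊗ θ p
  θ-^ p zero = begin
    θ (p ^ₚ 1)                  ≈⟨ θ-cong (≋-trans (^ₚ-suc p 0) (P.*-identityʳ p)) ⟩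
    θ p                         ≈⟨ solve 1 (λ x → x := 𝟙 :* 𝟙 :* x) P.refl (θ p) ⟩
    1ₚ ⊗ 1ₚ ⊗ θ p               ≈⟨ P.*-congʳ (P.*-congʳ (C-cong (+-identityʳ 1#))) ⟨
    C (fromℕ 1) ⊗ p ^ₚ 0 ⊗ θ p  ∎
    where open ≋-Reasoning
  θ-^ p (suc m) = begin
    θ (p ^ₚ suc (suc m))                                     ≈⟨ θ-cong (^ₚ-suc p (suc m)) ⟩
    θ (p ⊗ p ^ₚ suc m)                                       ≈⟨ θ-leibniz p (p ^ₚ suc m) ⟩
    θ p ⊗ p ^ₚ suc m ⊕ p ⊗ θ (p ^ₚ suc m)                    ≈⟨ P.+-cong (P.*-congˡ (^ₚ-suc p m)) (P.*-congˡ (θ-^ p m)) ⟩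
    θ p ⊗ (p ⊗ p ^ₚ m) ⊕ p ⊗ (C (fromℕ (suc m)) ⊗ p ^ₚ m ⊗ θ p)
      ≈⟨ solve 4 (λ θp x pm c → θp :* (x :* pm) :+ x :* (c :* pm :* θp) := (𝟙 :+ c) :* (x :* pm) :* θp)
                 P.refl (θ p) p (p ^ₚ m) (C (fromℕ (suc m))) ⟩
    (1ₚ ⊕ C (fromℕ (suc m))) ⊗ (p ⊗ p ^ₚ m) ⊗ θ p            ≈⟨ P.*-congʳ (P.*-cong (C-+ 1# _) (^ₚ-suc p m)) ⟨
    C (fromℕ (suc (suc m))) ⊗ p ^ₚ suc m ⊗ θ p               ∎
    where open ≋-Reasoning

  θ-t^ : ∀ m → θ (t ^ₚ m) ≋ C (fromℕ m) ⊗ t ^ₚ m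
  θ-t^ zero = begin
    θ 1ₚ             ≈⟨ θ-C 1# ⟩
    0ₚ               ≈⟨ P.zeroˡ 1ₚ ⟨
    0ₚ ⊗ 1ₚ          ≈⟨ P.*-congʳ 0∷[]≋[] ⟨
    C 0# ⊗ 1ₚ        ∎
    where open ≋-Reasoning
  θ-t^ (suc m) = begin
    θ (t ^ₚ suc m)                         ≈⟨ θ-^ t m ⟩
    C (fromℕ (suc m)) ⊗ t ^ₚ m ⊗ θ t       ≈⟨ P.*-congˡ θ-t ⟩
    C (fromℕ (suc m)) ⊗ t ^ₚ m ⊗ t         ≈⟨ P.*-assoc _ _ _ ⟩
    C (fromℕ (suc m)) ⊗ (t ^ₚ m ⊗ t)       ≈⟨ P.*-congˡ (≋-trans (P.*-comm _ t) (≋-sym (^ₚ-suc t m))) ⟩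
    C (fromℕ (suc m)) ⊗ t ^ₚ suc m         ∎
    where open ≋-Reasoning

  θ^ : ℕ → Pol → Pol
  θ^ zero p = p
  θ^ (suc r) p = θ (θ^ r p)

  θ^-cong : ∀ r {p q} → p ≋ q → θ^ r p ≋ θ^ r q
  θ^-cong zero e = e
  θ^-cong (suc r) e = θ-cong (θ^-cong r e)

  fromℕ≡×1# : ∀ m → fromℕ m ≡ m × 1#
  fromℕ≡×1# zero = ≡.refl
  fromℕ≡×1# (suc m) = ≡.cong (1# +_) (fromℕ≡×1# m)

  fromℕ-homo-* : ∀ m k → fromℕ (m ℕ.* k) ≈ fromℕ m * fromℕ k
  fromℕ-homo-* m k rewrite fromℕ≡×1# m | fromℕ≡×1# k | fromℕ≡×1# (m ℕ.* k) = ×1-homo-* m k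

  coeff-θ^ : ∀ r p k → coeff (θ^ r p) k ≈ fromℕ (k ℕ.^ r) * coeff p k
  coeff-θ^ zero p k = sym (trans (*-congʳ (+-identityʳ 1#)) (*-identityˡ _))
  coeff-θ^ (suc r) p k = begin
    coeff (θ (θ^ r p)) k                      ≈⟨ coeff-θ (θ^ r p) k ⟩
    fromℕ k * coeff (θ^ r p) k                ≈⟨ *-congˡ (coeff-θ^ r p k) ⟩
    fromℕ k * (fromℕ (k ℕ.^ r) * coeff p k)   ≈⟨ *-assoc _ _ _ ⟨
    (fromℕ k * fromℕ (k ℕ.^ r)) * coeff p k   ≈⟨ *-congʳ (fromℕ-homo-* k (k ℕ.^ r)) ⟨
    fromℕ (k ℕ.^ suc r) * coeff p k           ∎
    where open ≈-Reasoning

  -- By Leibniz, θ (Q^(k+1) Z) = (k + 1) Q^k θQ Z + Q^(k+1) θZ.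
  θ^-^ₚ⊗ : ∀ Q r k q → ∃₂ λ N Y →
    θ^ r (Q ^ₚ (k ℕ.+ r) ⊗ q) ≋ Q ^ₚ k ⊗ (C (fromℕ (suc N)) ⊗ (θ Q ^ₚ r ⊗ q) ⊕ Q ⊗ Y)
  θ^-^ₚ⊗ Q zero k q = 0 , 0ₚ , (begin
    Q ^ₚ (k ℕ.+ 0) ⊗ q                                ≡⟨ ≡.cong (λ e → Q ^ₚ e ⊗ q) (ℕP.+-identityʳ k) ⟩
    Q ^ₚ k ⊗ q                                        ≈⟨ solve 3 (λ x q y → x :* q := x :* (𝟙 :* (𝟙 :* q) :+ y :* 𝟘)) P.refl (Q ^ₚ k) q Q ⟩
    Q ^ₚ k ⊗ (1ₚ ⊗ (1ₚ ⊗ q) ⊕ Q ⊗ 0ₚ)                  ≈⟨ P.*-congˡ (P.+-congʳ (P.*-congʳ (C-cong (+-identityʳ 1#)))) ⟨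
    Q ^ₚ k ⊗ (C (fromℕ 1) ⊗ (θ Q ^ₚ 0 ⊗ q) ⊕ Q ⊗ 0ₚ)   ∎)
    where open ≋-Reasoning
  θ^-^ₚ⊗ Q (suc r) k q with θ^-^ₚ⊗ Q r (suc k) q
  ... | N , Y , expansion = N ℕ.+ k ℕ.* suc N , C (fromℕ (suc k)) ⊗ θ Q ⊗ Y ⊕ θ Z , (begin
    θ (θ^ r (Q ^ₚ (k ℕ.+ suc r) ⊗ q))               ≡⟨ ≡.cong (λ e → θ (θ^ r (Q ^ₚ e ⊗ q))) (ℕP.+-suc k r) ⟩
    θ (θ^ r (Q ^ₚ (suc k ℕ.+ r) ⊗ q))               ≈⟨ θ-cong expansion ⟩
    θ (Q ^ₚ suc k ⊗ Z)                              ≈⟨ θ-leibniz (Q ^ₚ suc k) Z ⟩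
    θ (Q ^ₚ suc k) ⊗ Z ⊕ Q ^ₚ suc k ⊗ θ Z           ≈⟨ P.+-cong (P.*-congʳ (θ-^ Q k)) (P.*-congʳ (^ₚ-suc Q k)) ⟩
    C (fromℕ (suc k)) ⊗ Q ^ₚ k ⊗ θ Q ⊗ (C (fromℕ (suc N)) ⊗ (θ Q ^ₚ r ⊗ q) ⊕ Q ⊗ Y) ⊕ (Q ⊗ Q ^ₚ k) ⊗ θ Z
      ≈⟨ solve 9 (λ ck x θQ cN pr q y Q′ θz → ck :* x :* θQ :* (cN :* (pr :* q) :+ Q′ :* y) :+ (Q′ :* x) :* θz
                   := x :* ((ck :* cN) :* ((θQ :* pr) :* q) :+ Q′ :* (ck :* θQ :* y :+ θz))) P.refl
           (C (fromℕ (suc k))) (Q ^ₚ k) (θ Q) (C (fromℕ (suc N))) (θ Q ^ₚ r) q Y Q (θ Z) ⟩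
    Q ^ₚ k ⊗ ((C (fromℕ (suc k)) ⊗ C (fromℕ (suc N))) ⊗ ((θ Q ⊗ θ Q ^ₚ r) ⊗ q) ⊕ Q ⊗ (C (fromℕ (suc k)) ⊗ θ Q ⊗ Y ⊕ θ Z))
      ≈⟨ P.*-congˡ (P.+-congʳ (P.*-cong c≋ (P.*-congʳ (≋-sym (^ₚ-suc (θ Q) r))))) ⟩
    Q ^ₚ k ⊗ (C (fromℕ (suc (N ℕ.+ k ℕ.* suc N))) ⊗ (θ Q ^ₚ suc r ⊗ q) ⊕ Q ⊗ (C (fromℕ (suc k)) ⊗ θ Q ⊗ Y ⊕ θ Z)) ∎)
    where
    open ≋-Reasoning
    Z = C (fromℕ (suc N)) ⊗ (θ Q ^ₚ r ⊗ q) ⊕ Q ⊗ Y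
    c≋ : C (fromℕ (suc k)) ⊗ C (fromℕ (suc N)) ≋ C (fromℕ (suc k ℕ.* suc N))
    c≋ = ≋-trans (≋-sym (C-* _ _)) (C-cong (sym (fromℕ-homo-* (suc k) (suc N))))

  ^ₚ-∣⇒∣-θ^ : ∀ Q l {g} → Q ^ₚ suc l ∣ g → ∀ r → r ℕ.≤ l → Q ∣ θ^ r g
  ^ₚ-∣⇒∣-θ^ Q l {g} (q , q⊗Q^ₚ≋g) r r≤l with θ^-^ₚ⊗ Q r (suc (l ℕ.∸ r)) q
  ... | N , Y , expansion = Q ^ₚ (l ℕ.∸ r) ⊗ X , (begin
    Q ^ₚ (l ℕ.∸ r) ⊗ X ⊗ Q          ≈⟨ solve 3 (λ a x b → a :* x :* b := b :* a :* x) P.refl _ X Q ⟩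
    Q ⊗ Q ^ₚ (l ℕ.∸ r) ⊗ X          ≈⟨ P.*-congʳ (^ₚ-suc Q (l ℕ.∸ r)) ⟨
    Q ^ₚ suc (l ℕ.∸ r) ⊗ X          ≈⟨ expansion ⟨
    θ^ r (Q ^ₚ (suc (l ℕ.∸ r) ℕ.+ r) ⊗ q) ≡⟨ ≡.cong (λ e → θ^ r (Q ^ₚ e ⊗ q)) exponent ⟩
    θ^ r (Q ^ₚ suc l ⊗ q)           ≈⟨ θ^-cong r (≋-trans (P.*-comm _ q) q⊗Q^ₚ≋g) ⟩
    θ^ r g                          ∎)
    where
    open ≋-Reasoning
    X = C (fromℕ (suc N)) ⊗ (θ Q ^ₚ r ⊗ q) ⊕ Q ⊗ Y
    exponent : suc (l ℕ.∸ r) ℕ.+ r ≡ suc l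
    exponent = ≡.cong suc (ℕP.m∸n+n≡m r≤l)

  -- Apply θ to (t - 1) [n] = t^n - 1 and substitute t^n = (t - 1) [n] + 1 back.
  [t-1]⊗θqInt : ∀ n → (t ⊖ 1ₚ) ⊗ θ (qInt n) ≋ C (fromℕ n) ⊕ (C (fromℕ n) ⊗ (t ⊖ 1ₚ) ⊖ t) ⊗ qInt n
  [t-1]⊗θqInt n = begin
    (t ⊖ 1ₚ) ⊗ θ Q
      ≈⟨ solve 3 (λ x t q → x := (t :* q :+ x) :- t :* q) P.refl _ t Q ⟩
    (t ⊗ Q ⊕ (t ⊖ 1ₚ) ⊗ θ Q) ⊖ t ⊗ Q
      ≈⟨ P.+-congʳ (P.+-congʳ (P.*-congʳ θ[t-1])) ⟨
    (θ (t ⊖ 1ₚ) ⊗ Q ⊕ (t ⊖ 1ₚ) ⊗ θ Q) ⊖ t ⊗ Q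
      ≈⟨ P.+-congʳ (θ-leibniz (t ⊖ 1ₚ) Q) ⟨
    θ ((t ⊖ 1ₚ) ⊗ Q) ⊖ t ⊗ Q
      ≈⟨ P.+-congʳ (θ-cong ([t-1]⊗qInt n)) ⟩
    θ (t ^ₚ n ⊖ 1ₚ) ⊖ t ⊗ Q
      ≈⟨ P.+-congʳ (≋-trans (θ-⊖ (t ^ₚ n) 1ₚ) (P.+-cong (θ-t^ n) (P.-‿cong (θ-C 1#)))) ⟩
    (C (fromℕ n) ⊗ t ^ₚ n ⊖ 0ₚ) ⊖ t ⊗ Q
      ≈⟨ P.+-congʳ (P.+-congʳ (P.*-congˡ t^n≋)) ⟩
    (C (fromℕ n) ⊗ ((t ⊖ 1ₚ) ⊗ Q ⊕ 1ₚ) ⊖ 0ₚ) ⊖ t ⊗ Q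
      ≈⟨ solve 3 (λ c t q → (c :* ((t :- 𝟙) :* q :+ 𝟙) :- 𝟘) :- t :* q
                          := c :+ (c :* (t :- 𝟙) :- t) :* q) P.refl (C (fromℕ n)) t Q ⟩
    C (fromℕ n) ⊕ (C (fromℕ n) ⊗ (t ⊖ 1ₚ) ⊖ t) ⊗ Q
      ∎
    where
    open ≋-Reasoning
    Q = qInt n
    t^n≋ : t ^ₚ n ≋ (t ⊖ 1ₚ) ⊗ Q ⊕ 1ₚ
    t^n≋ = ≋-trans (solve 1 (λ x → x := (x :- 𝟙) :+ 𝟙) P.refl (t ^ₚ n)) (P.+-congʳ (≋-sym ([t-1]⊗qInt n)))
    θ[t-1] : θ (t ⊖ 1ₚ) ≋ t
    θ[t-1] = begin
      θ (t ⊖ 1ₚ)    ≈⟨ θ-⊖ t 1ₚ ⟩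
      θ t ⊖ θ 1ₚ    ≈⟨ P.+-cong θ-t (P.-‿cong (θ-C 1#)) ⟩
      t ⊖ 0ₚ        ≈⟨ solve 1 (λ t → t :- 𝟘 := t) P.refl t ⟩
      t             ∎

module ResidueSums {c ℓ : Level} (R : CommutativeRing c ℓ) (n : ℕ) .{{n≢0 : NonZero n}} where
  open CommutativeRing R
  open Poly R
  open PolynomialRing R
  open EulerOperator R using (θ^; coeff-θ^)
  open RingDivisibility ⊕-⊗-commutativeRing using (_∣_; _,_; ∣-+; ∣ʳ-respʳ-≈)
  open import Algebra.Properties.Ring ring using (-0#≈0#; -‿anti-homo-+)
  private
    module P = CommutativeRing ⊕-⊗-commutativeRing
    module ≈-Reasoning = Relation.Binary.Reasoning.Setoid setoid
    module ≋-Reasoning = Relation.Binary.Reasoning.Setoid P.setoid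
  open IntegerCoefficientSolver ⊕-⊗-commutativeRing using (solve; _:+_; _:*_; _:-_; _:=_; 𝟙)

  -- σ j k p = Σ { p_i | k + i ≡ j mod n }, the list p being read from index k on.
  σ : ℕ → ℕ → Pol → Carrier
  σ j k [] = 0#
  σ j k (a ∷ p) with k % n ℕ.≟ j
  ... | yes _ = a + σ j (suc k) p
  ... | no _ = σ j (suc k) p

  σ-≋[] : ∀ j k {p} → p ≋ [] → σ j k p ≈ 0#
  σ-≋[] j k {[]} e = refl
  σ-≋[] j k {a ∷ p} e with k % n ℕ.≟ j
  ... | yes _ = trans (+-cong (coeff-≈ e 0) (σ-≋[] j (suc k) (≋-tail [] e))) (+-identityʳ 0#)
  ... | no _ = σ-≋[] j (suc k) (≋-tail [] e)

  σ-cong : ∀ j k {p q} → p ≋ q → σ j k p ≈ σ j k q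
  σ-cong j k {[]} e = sym (σ-≋[] j k (≋-sym e))
  σ-cong j k {a ∷ p} {[]} e = σ-≋[] j k e
  σ-cong j k {a ∷ p} {b ∷ q} e with k % n ℕ.≟ j
  ... | yes _ = +-cong (coeff-≈ e 0) (σ-cong j (suc k) (≋-tail (b ∷ q) e))
  ... | no _ = σ-cong j (suc k) (≋-tail (b ∷ q) e)

  σ-+ₚ : ∀ j k p q → σ j k (p +ₚ q) ≈ σ j k p + σ j k q
  σ-+ₚ j k [] q = sym (+-identityˡ _)
  σ-+ₚ j k (a ∷ p) [] = sym (+-identityʳ _)
  σ-+ₚ j k (a ∷ p) (b ∷ q) with k % n ℕ.≟ j
  ... | yes _ = trans (+-congˡ (σ-+ₚ j (suc k) p q)) (interchange a b _ _)
    where open import Algebra.Properties.CommutativeSemigroup +-commutativeSemigroup using (interchange)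
  ... | no _ = σ-+ₚ j (suc k) p q

  σ-negₚ : ∀ j k p → σ j k (negₚ p) ≈ - σ j k p
  σ-negₚ j k [] = sym -0#≈0#
  σ-negₚ j k (a ∷ p) with k % n ℕ.≟ j
  ... | yes _ = trans (+-congˡ (σ-negₚ j (suc k) p)) (trans (+-comm _ _) (sym (-‿anti-homo-+ a _)))
  ... | no _ = σ-negₚ j (suc k) p

  σ-⊕ : ∀ j k p q → σ j k (p ⊕ q) ≈ σ j k p + σ j k q
  σ-⊕ j k p q rewrite ⊕≡+ₚ p q = σ-+ₚ j k p q

  σ-⊝ : ∀ j k p → σ j k (⊝ p) ≈ - σ j k p
  σ-⊝ j k p rewrite ⊝≡negₚ p = σ-negₚ j k p

  σ-0∷ : ∀ j k p → σ j k (0# ∷ p) ≈ σ j (suc k) p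
  σ-0∷ j k p with k % n ℕ.≟ j
  ... | yes _ = +-identityˡ _
  ... | no _ = refl

  σ-t^⊗ : ∀ j k m p → σ j k (t ^ₚ m ⊗ p) ≈ σ j (k ℕ.+ m) p
  σ-t^⊗ j k zero p rewrite ℕP.+-identityʳ k = σ-cong j k (P.*-identityˡ p)
  σ-t^⊗ j k (suc m) p rewrite ℕP.+-suc k m = begin
    σ j k (t ^ₚ suc m ⊗ p)      ≈⟨ σ-cong j k (≋-trans (P.*-congʳ (^ₚ-suc t m)) (≋-trans (P.*-assoc t _ p) (t-⊗ _))) ⟩
    σ j k (0# ∷ t ^ₚ m ⊗ p)     ≈⟨ σ-0∷ j k _ ⟩
    σ j (suc k) (t ^ₚ m ⊗ p)    ≈⟨ σ-t^⊗ j (suc k) m p ⟩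
    σ j (suc k ℕ.+ m) p         ∎
    where open ≈-Reasoning

  σ-periodic : ∀ j k p → σ j (k ℕ.+ n) p ≡ σ j k p
  σ-periodic j k [] = ≡.refl
  σ-periodic j k (a ∷ p) with (k ℕ.+ n) % n ℕ.≟ j | k % n ℕ.≟ j
  ... | yes _ | yes _ = ≡.cong (a +_) (σ-periodic j (suc k) p)
  ... | no _ | no _ = σ-periodic j (suc k) p
  ... | yes e | no ¬e = contradiction (≡.trans (≡.sym ([m+n]%n≡m%n k n)) e) ¬e
  ... | no ¬e | yes e = contradiction (≡.trans ([m+n]%n≡m%n k n) e) ¬e

  suc-% : ∀ k → suc k % n ≡ suc (k % n) % n
  suc-% k = begin
    (1 ℕ.+ k) % n              ≡⟨ %-distribˡ-+ 1 k n ⟩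
    (1 % n ℕ.+ k % n) % n      ≡⟨ ≡.cong (λ x → (1 % n ℕ.+ x) % n) (m%n%n≡m%n k n) ⟨
    (1 % n ℕ.+ k % n % n) % n  ≡⟨ %-distribˡ-+ 1 (k % n) n ⟨
    (1 ℕ.+ k % n) % n          ∎
    where open ≡.≡-Reasoning

  %≡⇒suc-%≡ : ∀ {k j} → suc j ℕ.< n → k % n ≡ j → suc k % n ≡ suc j
  %≡⇒suc-%≡ {k} 1+j<n ≡.refl = ≡.trans (suc-% k) (m<n⇒m%n≡m 1+j<n)

  suc-%≡⇒%≡ : ∀ {k j} → suc j ℕ.< n → suc k % n ≡ suc j → k % n ≡ j
  suc-%≡⇒%≡ {k} 1+j<n e with ℕP.m≤n⇒m<n∨m≡n (m%n<n k n)
  ... | inj₁ 1+k%n<n = ℕP.suc-injective (≡.trans (≡.sym (m<n⇒m%n≡m 1+k%n<n)) (≡.trans (≡.sym (suc-% k)) e))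
  ... | inj₂ 1+k%n≡n = contradiction 0≡1+j ℕP.0≢1+n
    where
    0≡1+j = ≡.trans (≡.sym (n%n≡0 n)) (≡.trans (≡.cong (_% n) (≡.sym 1+k%n≡n)) (≡.trans (≡.sym (suc-% k)) e))

  σ-suc : ∀ j k p → suc j ℕ.< n → σ (suc j) (suc k) p ≡ σ j k p
  σ-suc j k [] _ = ≡.refl
  σ-suc j k (a ∷ p) 1+j<n with suc k % n ℕ.≟ suc j | k % n ℕ.≟ j
  ... | yes _ | yes _ = ≡.cong (a +_) (σ-suc j (suc k) p 1+j<n)
  ... | no _ | no _ = σ-suc j (suc k) p 1+j<n
  ... | yes e | no ¬e = contradiction (suc-%≡⇒%≡ 1+j<n e) ¬e
  ... | no ¬e | yes e = contradiction (%≡⇒suc-%≡ 1+j<n e) ¬e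

  0%n≡0 : 0 % n ≡ 0
  0%n≡0 = m<n⇒m%n≡m (ℕ.>-nonZero⁻¹ n)

  σ-vanish : ∀ k p → suc k ℕ.+ length p ℕ.≤ n → σ 0 (suc k) p ≈ 0#
  σ-vanish k [] _ = refl
  σ-vanish k (a ∷ p) bound with suc k % n ℕ.≟ 0
  ... | yes e = contradiction (≡.trans (≡.sym (m<n⇒m%n≡m 1+k<n)) e) λ ()
    where 1+k<n = ℕP.<-≤-trans (ℕP.m<m+n (suc k) ℕP.0<1+n) bound
  ... | no _ = σ-vanish (suc k) p (ℕP.≤-trans (ℕP.≤-reflexive (≡.sym (ℕP.+-suc (suc k) (length p)))) bound)

  σ≈coeff : ∀ p → length p ℕ.≤ n → ∀ j → j ℕ.< n → σ j 0 p ≈ coeff p j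
  σ≈coeff [] _ j _ = refl
  σ≈coeff (a ∷ p) bound zero _ with 0 % n ℕ.≟ 0
  ... | yes _ = trans (+-congˡ (σ-vanish 0 p bound)) (+-identityʳ a)
  ... | no ¬e = contradiction 0%n≡0 ¬e
  σ≈coeff (a ∷ p) bound (suc j) 1+j<n with 0 % n ℕ.≟ suc j
  ... | yes e = contradiction (≡.trans (≡.sym 0%n≡0) e) λ ()
  ... | no _ = begin
    σ (suc j) 1 p   ≡⟨ σ-suc j 0 p 1+j<n ⟩
    σ j 0 p         ≈⟨ σ≈coeff p (ℕP.<⇒≤ bound) j (ℕP.<-trans (ℕP.n<1+n j) 1+j<n) ⟩
    coeff p j       ∎
    where open ≈-Reasoning

  EqualResidueSums : Pol → Set ℓ
  EqualResidueSums f = ∀ j → j ℕ.< n → σ j 0 f ≈ σ 0 0 f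

  σ-t⊗ : ∀ j k f → σ j k (t ⊗ f) ≈ σ j (suc k) f
  σ-t⊗ j k f = trans (σ-cong j k (t-⊗ f)) (σ-0∷ j k f)

  σ-t^n⊗ : ∀ j f → σ j 0 (t ^ₚ n ⊗ f) ≈ σ j 0 f
  σ-t^n⊗ j f = trans (σ-t^⊗ j 0 n f) (reflexive (σ-periodic j 0 f))

  -- Multiplying a multiple of [n] by t changes it by a multiple of t^n - 1, on which σ vanishes.
  σ-shift-invariant : ∀ {f} → qInt n ∣ f → ∀ j → σ j 1 f ≈ σ j 0 f
  σ-shift-invariant {f} (q , q⊗Q≋f) j = begin
    σ j 1 f                                         ≈⟨ σ-t⊗ j 0 f ⟨
    σ j 0 (t ⊗ f)                                   ≈⟨ σ-cong j 0 t⊗f≋ ⟩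
    σ j 0 (f ⊕ (t ^ₚ n ⊗ q ⊖ q))                    ≈⟨ σ-⊕ j 0 f _ ⟩
    σ j 0 f + σ j 0 (t ^ₚ n ⊗ q ⊖ q)                ≈⟨ +-congˡ (trans (σ-⊕ j 0 _ (⊝ q)) (+-cong (σ-t^n⊗ j q) (σ-⊝ j 0 q))) ⟩
    σ j 0 f + (σ j 0 q - σ j 0 q)                   ≈⟨ trans (+-congˡ (-‿inverseʳ _)) (+-identityʳ _) ⟩
    σ j 0 f                                         ∎
    where
    open ≈-Reasoning
    t⊗f≋ : t ⊗ f ≋ f ⊕ (t ^ₚ n ⊗ q ⊖ q)
    t⊗f≋ = ≋-trans (P.*-congˡ (≋-sym q⊗Q≋f)) (≋-trans
      (solve 3 (λ t q Q → t :* (q :* Q) := q :* Q :+ ((t :- 𝟙) :* Q) :* q) P.refl t q (qInt n))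
      (P.+-cong q⊗Q≋f (≋-trans (P.*-congʳ ([t-1]⊗qInt n))
        (solve 2 (λ x q → (x :- 𝟙) :* q := x :* q :- q) P.refl (t ^ₚ n) q))))

  qInt-∣⇒equalResidueSums : ∀ {f} → qInt n ∣ f → EqualResidueSums f
  qInt-∣⇒equalResidueSums d zero _ = refl
  qInt-∣⇒equalResidueSums {f} d (suc j) 1+j<n = begin
    σ (suc j) 0 f   ≈⟨ σ-shift-invariant d (suc j) ⟨
    σ (suc j) 1 f   ≡⟨ σ-suc j 0 f 1+j<n ⟩
    σ j 0 f         ≈⟨ qInt-∣⇒equalResidueSums d j (ℕP.<-trans (ℕP.n<1+n j) 1+j<n) ⟩
    σ 0 0 f         ∎
    where open ≈-Reasoning

  -- For deg f < n the residue sums are the coefficients of f.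
  equalResidueSums⇒≋C⊗qInt : ∀ {f} → length f ℕ.≤ n → EqualResidueSums f → f ≋ C (σ 0 0 f) ⊗ qInt n
  equalResidueSums⇒≋C⊗qInt {f} bound equal = ≋-trans (mk≋ coeffs) (≋-sym (C-⊗ a (qInt n)))
    where
    a = σ 0 0 f
    coeffs : f ≈ₚ map (a *_) (qInt n)
    coeffs i with i ℕ.<? n
    ... | yes i<n = begin
      coeff f i                    ≈⟨ σ≈coeff f bound i i<n ⟨
      σ i 0 f                      ≈⟨ equal i i<n ⟩
      a                            ≈⟨ *-identityʳ a ⟨
      a * 1#                       ≡⟨ ≡.cong (a *_) (coeff-replicate n 1# i<n) ⟨
      a * coeff (qInt n) i         ≈⟨ coeff-scale a (qInt n) i ⟨
      coeff (map (a *_) (qInt n)) i ∎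
      where open ≈-Reasoning
    ... | no i≮n = begin
      coeff f i                    ≡⟨ coeff-≥length f (ℕP.≤-trans bound n≤i) ⟩
      0#                           ≈⟨ zeroʳ a ⟨
      a * 0#                       ≡⟨ ≡.cong (a *_) (coeff-≥length (qInt n) (ℕP.≤-trans (ℕP.≤-reflexive (LP.length-replicate n)) n≤i)) ⟨
      a * coeff (qInt n) i         ≈⟨ coeff-scale a (qInt n) i ⟨
      coeff (map (a *_) (qInt n)) i ∎
      where
      open ≈-Reasoning
      n≤i = ℕP.≮⇒≥ i≮n

  fold : Pol → Pol
  fold f = take n f +ₚ drop n f

  fold-≋ : ∀ f → f ≋ fold f ⊕ (t ^ₚ n ⊖ 1ₚ) ⊗ drop n f
  fold-≋ f = begin
    f                                               ≈⟨ take⊕drop n f ⟩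
    take n f ⊕ t ^ₚ n ⊗ drop n f                    ≈⟨ solve 3 (λ a x b → a :+ x :* b := (a :+ b) :+ (x :- 𝟙) :* b) P.refl (take n f) (t ^ₚ n) (drop n f) ⟩
    (take n f ⊕ drop n f) ⊕ (t ^ₚ n ⊖ 1ₚ) ⊗ drop n f ≡⟨ ≡.cong (_⊕ (t ^ₚ n ⊖ 1ₚ) ⊗ drop n f) (⊕≡+ₚ (take n f) (drop n f)) ⟩
    fold f ⊕ (t ^ₚ n ⊖ 1ₚ) ⊗ drop n f               ∎
    where open ≋-Reasoning

  σ-fold : ∀ j f → σ j 0 (fold f) ≈ σ j 0 f
  σ-fold j f = begin
    σ j 0 (take n f +ₚ drop n f)                    ≈⟨ σ-+ₚ j 0 (take n f) (drop n f) ⟩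
    σ j 0 (take n f) + σ j 0 (drop n f)             ≈⟨ +-congˡ (σ-t^n⊗ j (drop n f)) ⟨
    σ j 0 (take n f) + σ j 0 (t ^ₚ n ⊗ drop n f)    ≈⟨ σ-⊕ j 0 (take n f) _ ⟨
    σ j 0 (take n f ⊕ t ^ₚ n ⊗ drop n f)            ≈⟨ σ-cong j 0 (take⊕drop n f) ⟨
    σ j 0 f                                         ∎
    where open ≈-Reasoning

  length-fold : ∀ m f → length f ℕ.≤ n ℕ.+ suc m → length (fold f) ℕ.≤ n ℕ.+ m
  length-fold m f bound rewrite length-+ₚ (take n f) (drop n f) = ℕP.⊔-lub length-take length-drop
    where
    length-take : length (take n f) ℕ.≤ n ℕ.+ m
    length-take = ℕP.≤-trans (ℕP.≤-reflexive (LP.length-take n f)) (ℕP.≤-trans (ℕP.m⊓n≤m n _) (ℕP.m≤m+n n m))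
    length-drop : length (drop n f) ℕ.≤ n ℕ.+ m
    length-drop = begin
      length (drop n f)       ≡⟨ LP.length-drop n f ⟩
      length f ℕ.∸ n          ≤⟨ ℕP.∸-monoˡ-≤ n bound ⟩
      (n ℕ.+ suc m) ℕ.∸ n     ≡⟨ ℕP.m+n∸m≡n n (suc m) ⟩
      suc m                   ≤⟨ ℕP.+-monoˡ-≤ m (ℕ.>-nonZero⁻¹ n) ⟩
      n ℕ.+ m                 ∎
      where open ℕP.≤-Reasoning

  equalResidueSums⇒qInt-∣ : ∀ {f} → EqualResidueSums f → qInt n ∣ f
  equalResidueSums⇒qInt-∣ {f} = go (length f) f (ℕP.m≤n+m (length f) n)
    where
    go : ∀ m f → length f ℕ.≤ n ℕ.+ m → EqualResidueSums f → qInt n ∣ f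
    go zero f bound equal =
      C (σ 0 0 f) , ≋-sym (equalResidueSums⇒≋C⊗qInt (ℕP.≤-trans bound (ℕP.≤-reflexive (ℕP.+-identityʳ n))) equal)
    go (suc m) f bound equal = ∣ʳ-respʳ-≈ (≋-sym (fold-≋ f)) (∣-+ fold-divisible ((t ⊖ 1ₚ) ⊗ drop n f , t^n-1-multiple))
      where
      fold-divisible : qInt n ∣ fold f
      fold-divisible = go m (fold f) (length-fold m f bound)
        λ j j<n → trans (σ-fold j f) (trans (equal j j<n) (sym (σ-fold 0 f)))
      t^n-1-multiple : (t ⊖ 1ₚ) ⊗ drop n f ⊗ qInt n ≋ (t ^ₚ n ⊖ 1ₚ) ⊗ drop n f
      t^n-1-multiple = ≋-trans (solve 3 (λ a b c → a :* b :* c := a :* c :* b) P.refl _ _ (qInt n)) (P.*-congʳ ([t-1]⊗qInt n))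

  weighted : ℕ → ℕ → Pol → Pol
  weighted r k [] = []
  weighted r k (a ∷ g) = a * fromℕ (k ℕ.^ r) ∷ weighted r (suc k) g

  resSumFrom≈σ-weighted : ∀ j r k g → resSumFrom n j r k g ≈ σ j k (weighted r k g)
  resSumFrom≈σ-weighted j r k [] = refl
  resSumFrom≈σ-weighted j r k (a ∷ g) with k % n ℕ.≟ j
  ... | yes _ = +-congˡ (resSumFrom≈σ-weighted j r (suc k) g)
  ... | no _ = resSumFrom≈σ-weighted j r (suc k) g

  coeff-weighted : ∀ r k g i → coeff (weighted r k g) i ≈ fromℕ ((k ℕ.+ i) ℕ.^ r) * coeff g i
  coeff-weighted r k [] i = sym (zeroʳ _)
  coeff-weighted r k (a ∷ g) zero rewrite ℕP.+-identityʳ k = *-comm a _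
  coeff-weighted r k (a ∷ g) (suc i) rewrite ℕP.+-suc k i = coeff-weighted r (suc k) g i

  resSum≈σ-θ^ : ∀ j r g → resSumFrom n j r 0 g ≈ σ j 0 (θ^ r g)
  resSum≈σ-θ^ j r g = trans (resSumFrom≈σ-weighted j r 0 g)
    (σ-cong j 0 weighted≋θ^)
    where
    weighted≋θ^ : weighted r 0 g ≋ θ^ r g
    weighted≋θ^ = mk≋ λ i → trans (coeff-weighted r 0 g i) (sym (coeff-θ^ r g i))

  qInt-∣⇔equalResidueSums : ∀ {f} → qInt n ∣ f ⇔ EqualResidueSums f
  qInt-∣⇔equalResidueSums = mk⇔ qInt-∣⇒equalResidueSums equalResidueSums⇒qInt-∣

  equalResidueSums-θ^⇔ : ∀ r g → EqualResidueSums (θ^ r g) ⇔ (∀ (i j : Fin n) → resSum n i r g ≈ resSum n j r g)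
  equalResidueSums-θ^⇔ r g = mk⇔
    (λ equal i j → begin
      resSum n i r g            ≈⟨ resSum≈σ-θ^ (toℕ i) r g ⟩
      σ (toℕ i) 0 (θ^ r g)      ≈⟨ equal (toℕ i) (FinP.toℕ<n i) ⟩
      σ 0 0 (θ^ r g)            ≈⟨ equal (toℕ j) (FinP.toℕ<n j) ⟨
      σ (toℕ j) 0 (θ^ r g)      ≈⟨ resSum≈σ-θ^ (toℕ j) r g ⟨
      resSum n j r g            ∎)
    (λ equal j j<n → begin
      σ j 0 (θ^ r g)            ≈⟨ resSum≈σ-θ^ j r g ⟨
      resSumFrom n j r 0 g      ≡⟨ resSum-fromℕ< j<n ⟨
      resSum n (fromℕ< j<n) r g ≈⟨ equal (fromℕ< j<n) (fromℕ< 0<n) ⟩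
      resSum n (fromℕ< 0<n) r g ≡⟨ resSum-fromℕ< 0<n ⟩
      resSumFrom n 0 r 0 g      ≈⟨ resSum≈σ-θ^ 0 r g ⟩
      σ 0 0 (θ^ r g)            ∎)
    where
    open ≈-Reasoning
    0<n = ℕ.>-nonZero⁻¹ n
    resSum-fromℕ< : ∀ {j} (j<n : j ℕ.< n) → resSum n (fromℕ< j<n) r g ≡ resSumFrom n j r 0 g
    resSum-fromℕ< j<n = ≡.cong (λ j → resSumFrom n j r 0 g) (FinP.toℕ-fromℕ< j<n)

  qInt-∣-θ^⇔resSums-equal : ∀ r g → qInt n ∣ θ^ r g ⇔ (∀ (i j : Fin n) → resSum n i r g ≈ resSum n j r g)
  qInt-∣-θ^⇔resSums-equal r g = equalResidueSums-θ^⇔ r g ⇔-∘ qInt-∣⇔equalResidueSums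

PositiveIntegersInvertible : ∀ {c ℓ} → CommutativeRing c ℓ → Set (c ⊔ ℓ)
PositiveIntegersInvertible R = ∀ m → ∃ λ y → fromℕ (suc m) * y ≈ 1#
  where
  open CommutativeRing R
  open Poly R using (fromℕ)

module DivisibilityByPowers {c ℓ : Level} (R : CommutativeRing c ℓ)
  (fromℕ-suc-invertible : PositiveIntegersInvertible R) where
  open CommutativeRing R
  open Poly R
  open PolynomialRing R
  open EulerOperator R
  open RingDivisibility ⊕-⊗-commutativeRing
    using (_∣_; _,_; ∣--; ∣ʳ-respˡ-≈; ∣ʳ-respʳ-≈; x∣xy; x∣ʳy⇒xz∣ʳyz; UnitModulo; unitModulo-∣-cancel)
  private
    module P = CommutativeRing ⊕-⊗-commutativeRing
    module ≋-Reasoning = Relation.Binary.Reasoning.Setoid P.setoid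
  open IntegerCoefficientSolver ⊕-⊗-commutativeRing using (solve; _:+_; _:*_; _:-_; _:=_; 𝟘; 𝟙)

  C-unitModulo : ∀ m Q → UnitModulo Q (C (fromℕ (suc m)))
  C-unitModulo m Q with fromℕ-suc-invertible m
  ... | y , m+1*y≈1 = C y , 0ₚ , (begin
    C y ⊗ C (fromℕ (suc m))   ≈⟨ C-* y _ ⟨
    C (y * fromℕ (suc m))     ≈⟨ C-cong (trans (*-comm y _) m+1*y≈1) ⟩
    1ₚ                        ≈⟨ solve 1 (λ Q → 𝟙 := 𝟙 :+ 𝟘 :* Q) P.refl Q ⟩
    1ₚ ⊕ 0ₚ ⊗ Q               ∎)
    where open ≋-Reasoning

  θqInt-unitModulo : ∀ n′ → UnitModulo (qInt (suc n′)) (θ (qInt (suc n′)))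
  θqInt-unitModulo n′ with fromℕ-suc-invertible n′
  ... | y , n*y≈1 = C y ⊗ (t ⊖ 1ₚ) , C y ⊗ W , (begin
    C y ⊗ (t ⊖ 1ₚ) ⊗ θ Q              ≈⟨ P.*-assoc _ _ _ ⟩
    C y ⊗ ((t ⊖ 1ₚ) ⊗ θ Q)            ≈⟨ P.*-congˡ ([t-1]⊗θqInt (suc n′)) ⟩
    C y ⊗ (C n ⊕ W ⊗ Q)               ≈⟨ solve 4 (λ y n w q → y :* (n :+ w :* q) := y :* n :+ y :* w :* q) P.refl (C y) (C n) W Q ⟩
    C y ⊗ C n ⊕ C y ⊗ W ⊗ Q           ≈⟨ P.+-congʳ (≋-trans (≋-sym (C-* y n)) (C-cong (trans (*-comm y n) n*y≈1))) ⟩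
    1ₚ ⊕ C y ⊗ W ⊗ Q                  ∎)
    where
    open ≋-Reasoning
    Q = qInt (suc n′)
    n = fromℕ (suc n′)
    W = C n ⊗ (t ⊖ 1ₚ) ⊖ t

  unitModulo-^ₚ-∣-cancel : ∀ {Q a} → UnitModulo Q a → ∀ m {y} → Q ∣ a ^ₚ m ⊗ y → Q ∣ y
  unitModulo-^ₚ-∣-cancel unit zero d = ∣ʳ-respʳ-≈ (P.*-identityˡ _) d
  unitModulo-^ₚ-∣-cancel {a = a} unit (suc m) {y} d = unitModulo-^ₚ-∣-cancel unit m
    (unitModulo-∣-cancel unit (∣ʳ-respʳ-≈ (≋-trans (P.*-congʳ (^ₚ-suc a m)) (P.*-assoc a _ y)) d))

  -- If g = q Q^m, then θ^m g ≡ c (θQ)^m q modulo Q for a positive integer c (θ^-^ₚ⊗),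
  -- and c (θQ)^m is a unit modulo Q.
  ^ₚ-∣-step : ∀ {Q} → UnitModulo Q (θ Q) → ∀ m {g} → Q ^ₚ m ∣ g → Q ∣ θ^ m g → Q ^ₚ suc m ∣ g
  ^ₚ-∣-step {Q} θQ-unit m {g} (q , q⊗Q^m≋g) Q∣θ^mg with θ^-^ₚ⊗ Q m 0 q
  ... | N , Y , expansion =
    ∣ʳ-respˡ-≈ (≋-sym (^ₚ-suc Q m)) (∣ʳ-respʳ-≈ q⊗Q^m≋g (x∣ʳy⇒xz∣ʳyz (Q ^ₚ m) Q∣q))
    where
    Q∣expansion : Q ∣ 1ₚ ⊗ (C (fromℕ (suc N)) ⊗ (θ Q ^ₚ m ⊗ q) ⊕ Q ⊗ Y)
    Q∣expansion = ∣ʳ-respʳ-≈ (≋-trans (θ^-cong m (≋-trans (≋-sym q⊗Q^m≋g) (P.*-comm q _))) expansion) Q∣θ^mg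
    Q∣q : Q ∣ q
    Q∣q = unitModulo-^ₚ-∣-cancel θQ-unit m (unitModulo-∣-cancel (C-unitModulo N Q)
      (∣ʳ-respʳ-≈ (solve 2 (λ x y → 𝟙 :* (x :+ y) :- y := x) P.refl _ (Q ⊗ Y)) (∣-- Q∣expansion (x∣xy Q Y))))

  ∣-θ^⇒^ₚ-∣ : ∀ {Q} → UnitModulo Q (θ Q) → ∀ l {g} → (∀ r → r ℕ.≤ l → Q ∣ θ^ r g) → Q ^ₚ suc l ∣ g
  ∣-θ^⇒^ₚ-∣ {Q} θQ-unit l {g} Q∣θ^g = go (suc l) ℕP.≤-refl
    where
    go : ∀ m → m ℕ.≤ suc l → Q ^ₚ m ∣ g
    go zero _ = g , P.*-identityʳ g
    go (suc m) (ℕ.s≤s m≤l) = ^ₚ-∣-step θQ-unit m (go m (ℕP.m≤n⇒m≤1+n m≤l)) (Q∣θ^g m m≤l)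

  qInt-^ₚ-∣⇔∣-θ^ : ∀ n′ l {g} → qInt (suc n′) ^ₚ suc l ∣ g ⇔ (∀ r → r ℕ.≤ l → qInt (suc n′) ∣ θ^ r g)
  qInt-^ₚ-∣⇔∣-θ^ n′ l = mk⇔ (^ₚ-∣⇒∣-θ^ (qInt (suc n′)) l) (∣-θ^⇒^ₚ-∣ (θqInt-unitModulo n′) l)

∀≤-cong-⇔ : ∀ {a b} {A : ℕ → Set a} {B : ℕ → Set b} {l} →
  (∀ r → A r ⇔ B r) → (∀ r → r ≤ l → A r) ⇔ (∀ r → r ≤ l → B r)
∀≤-cong-⇔ A⇔B = mk⇔ (λ h r r≤l → to (A⇔B r) (h r r≤l)) (λ h r r≤l → from (A⇔B r) (h r r≤l))

lemma2p3 : ∀ {c ℓ : Level} (F : CharZeroField c ℓ) → let open CharZeroField F in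
    (g : List Carrier) (n : ℕ) .{{_ : NonZero n}} (l : ℕ) →
    (qInt n ^ₚ suc l) ∣ₚ g ⇔ (∀ (r : ℕ) → r ≤ l → ∀ (i j : Fin n) → resSum n i r g ≈ resSum n j r g)
lemma2p3 F g zero {{n≢0}} l = ⊥-elim-irr (NonZero.nonZero n≢0)
lemma2p3 F g (suc n′) l =
  (∀≤-cong-⇔ (λ r → qInt-∣-θ^⇔resSums-equal r g) ⇔-∘ qInt-^ₚ-∣⇔∣-θ^ n′ l) ⇔-∘ ∣ₚ⇔∣
  where
  open CharZeroField F
  open PolynomialRing commutativeRing using (∣ₚ⇔∣)
  open ResidueSums commutativeRing (suc n′) using (qInt-∣-θ^⇔resSums-equal)
  positiveIntegersInvertible : PositiveIntegersInvertible commutativeRing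
  positiveIntegersInvertible m = inverse (fromℕ (suc m)) (charZero m)
  open DivisibilityByPowers commutativeRing positiveIntegersInvertible using (qInt-^ₚ-∣⇔∣-θ^)
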